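{- For every positive integer $n$, $$t(1,1,1,6;n)=\frac 16\big(N(1,1,1,6;32n+36)-N(1,1,1,6;8n+9)\big).$$
   Context: For positive integers $a_1,\dots,a_k$ and a nonnegative integer $n$, $N(a_1,\dots,a_k;n)$ is the number of $(x_1,\dots,x_k)\in\mathbb Z^k$ with $n=a_1x_1^2+\cdots+a_kx_k^2$, and $t(a_1,\dots,a_k;n)$ is the number of $(x_1,\dots,x_k)\in\mathbb Z^k$ with $n=a_1\frac{x_1(x_1-1)}2+\cdots+a_k\frac{x_k(x_k-1)}2$. -}

module Defs where

open import Data.Nat as ℕ using (ℕ; zero; suc; _/_)
open import Data.Integer as ℤ using (ℤ; +_; ∣_∣)
open import Data.List using (List; []; _∷_; map; concatMap; zipWith; filter; length; upTo)
open import Data.Nat.ListAction using (sum)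
open import Data.Nat.Properties using (_≟_)

range : ℕ → List ℤ
range B = map (λ i → (+ i) ℤ.- (+ B)) (upTo (suc (B ℕ.+ B)))

tuples : ℕ → List ℤ → List (List ℤ)
tuples zero    r = [] ∷ []
tuples (suc k) r = concatMap (λ x → map (x ∷_) (tuples k r)) r

sq : ℤ → ℕ
sq x = ∣ x ∣ ℕ.* ∣ x ∣

-- x(x-1)/2 (as a natural number; x(x-1) ≥ 0 and is even for every integer x)
tri : ℤ → ℕ
tri x = ∣ x ℤ.* (x ℤ.- + 1) ∣ / 2

form : (ℤ → ℕ) → List ℕ → List ℤ → ℕ
form f as xs = sum (zipWith (λ a x → a ℕ.* f x) as xs)

-- Number of (x_1,...,x_k) ∈ ℤ^k with a_1 f(x_1)+...+a_k f(x_k) = n, where the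
-- search is over the box [-(n+1), n+1]^k.  For positive a_i and f ∈ {sq, tri}
-- every solution lies in this box (|x| ≤ x^2, and |x| ≥ n+2 ⇒ x(x-1)/2 > n),
-- so this is exactly the number of solutions in ℤ^k.
count : (ℤ → ℕ) → List ℕ → ℕ → ℕ
count f as n =
  length (filter (λ xs → form f as xs ≟ n) (tuples (length as) (range (suc n))))

N : List ℕ → ℕ → ℕ
N = count sq

t : List ℕ → ℕ → ℕ
t = count tri

module Submission where

open import Defs

-- Write Q(a, b, c, d) = a² + b² + c² + 6d².  Since 8 · x(x - 1)/2 + 1 = (2x - 1)², t(n) counts the
-- x ∈ ℤ⁴ with Q(2x - 1) = 8n + 9, i.e. the representations of K = 8n + 9 by Q with all entries odd,
-- so it suffices to show N(4K) = N(K) + 6 · #{odd representations of K} whenever K ≡ 1 (mod 8).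
-- Modulo 8, a representation of 4K with d even has all entries even, and halving them gives exactly
-- the representations of K.  If d is odd, exactly one of a, b, c is even; moving it to the third
-- place accounts for a factor 3, and the sign changes d ↦ -d and b ↦ -b halve the rest twice, down
-- to the representations with a ≡ -d and a ≡ b (mod 4).  These are precisely the images, under an
-- affine map φ with Q(φ x) = 4 Q(2x - 1), of the odd representations with x₁ + x₂ odd, which are half
-- of all odd representations (exchange x₂ and 1 - x₂).  Hence N(4K) - N(K) = 3 · 2 · 2 · ½ times the
-- number of odd representations of K.  The congruence facts are checked on residues mod 4, and mod 16
-- for the integrality of φ⁻¹.

module FiniteSets where

  open import Data.Nat using (ℕ; suc; _+_; _*_)
  open import Data.Nat.Properties using (+-suc)
  open import Data.Nat.Tactic.RingSolver using (solve-∀)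
  open import Data.List using (List; []; _∷_; length; map; filter)
  open import Data.List.Properties using (length-map)
  open import Data.List.Membership.Propositional using (_∈_)
  open import Data.List.Membership.Propositional.Properties using (∈-map⁺; ∈-map⁻; ∈-filter⁺; ∈-filter⁻)
  open import Data.List.Membership.Propositional.Properties.WithK using (unique∧set⇒bag)
  open import Data.List.Relation.Binary.BagAndSetEquality using (∼bag⇒↭)
  open import Data.List.Relation.Binary.Permutation.Propositional.Properties using (↭-length)
  open import Data.List.Relation.Unary.All as All using (All; []; _∷_)
  import Data.List.Relation.Unary.All.Properties as All
  open import Data.List.Relation.Unary.Unique.Propositional using (Unique; []; _∷_)
  import Data.List.Relation.Unary.Unique.Propositional.Properties as Unique
  open import Data.Product using (∃; _×_; _,_; proj₁; proj₂)
  open import Function using (_∘_; mk⇔)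
  open import Level using (0ℓ)
  open import Relation.Binary.PropositionalEquality
    using (_≡_; refl; sym; trans; cong; subst; module ≡-Reasoning)
  open import Relation.Nullary using (¬_; ¬?; yes; no)
  open import Relation.Nullary.Decidable using (_×-dec_; _→-dec_)
  open import Relation.Unary using (Pred; Decidable; _∩_)
  open import Relation.Unary.Properties using (∁?)

  private
    variable
      A B : Set
      P Q R : Pred A 0ℓ

  record Enumeration {A : Set} (P : Pred A 0ℓ) : Set where
    field
      elements : List A
      unique   : Unique elements
      sound    : ∀ {x} → x ∈ elements → P x
      complete : ∀ {x} → P x → x ∈ elements

  open Enumeration

  enumerate : ∀ {xs : List A} → Unique xs → Enumeration (_∈ xs)
  enumerate {xs = xs} xs-unique = record
    { elements = xs ; unique = xs-unique ; sound = λ x∈ → x∈ ; complete = λ x∈ → x∈ }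

  size : Enumeration P → ℕ
  size = length ∘ elements

  size-unique : (E F : Enumeration P) → size E ≡ size F
  size-unique E F = ↭-length (∼bag⇒↭ (unique∧set⇒bag (unique E) (unique F)
    (mk⇔ (complete F ∘ sound E) (complete E ∘ sound F))))

  unique-map : (f : A → B) → (∀ {x y} → P x → P y → f x ≡ f y → x ≡ y) →
               ∀ {xs} → All P xs → Unique xs → Unique (map f xs)
  unique-map f inj []         []         = []
  unique-map f inj (px ∷ pxs) (x∉ ∷ uxs) =
    All.map⁺ (All.zipWith (λ (py , x≢y) → x≢y ∘ inj px py) (pxs , x∉)) ∷ unique-map f inj pxs uxs

  image : (E : Enumeration P) (f : A → B) →
          (∀ {x y} → P x → P y → f x ≡ f y → x ≡ y) →
          (∀ {x} → P x → Q (f x)) →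
          (∀ {y} → Q y → ∃ λ x → P x × f x ≡ y) →
          Enumeration Q
  image {Q = Q} E f inj into onto = record
    { elements = map f (elements E)
    ; unique   = unique-map f inj (All.tabulate (sound E)) (unique E)
    ; sound    = λ m → let (x , x∈ , y≡fx) = ∈-map⁻ f m in
                       subst Q (sym y≡fx) (into (sound E x∈))
    ; complete = λ qy → let (x , px , fx≡y) = onto qy in
                        subst (_∈ _) fx≡y (∈-map⁺ f (complete E px))
    }

  size-image : (E : Enumeration P) (f : A → B) →
               (inj : ∀ {x y} → P x → P y → f x ≡ f y → x ≡ y) →
               (into : ∀ {x} → P x → Q (f x)) →
               (onto : ∀ {y} → Q y → ∃ λ x → P x × f x ≡ y) →
               size (image E f inj into onto) ≡ size E
  size-image E f _ _ _ = length-map f (elements E)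

  size-bij : (E : Enumeration P) (F : Enumeration Q) (f : A → B) →
             (∀ {x y} → P x → P y → f x ≡ f y → x ≡ y) →
             (∀ {x} → P x → Q (f x)) →
             (∀ {y} → Q y → ∃ λ x → P x × f x ≡ y) →
             size E ≡ size F
  size-bij E F f inj into onto =
    trans (sym (size-image E f inj into onto)) (size-unique (image E f inj into onto) F)

  size-exchange : (E : Enumeration P) (F : Enumeration Q) (ι : A → A) → (∀ x → ι (ι x) ≡ x) →
                  (∀ {x} → P x → Q (ι x)) → (∀ {x} → Q x → P (ι x)) → size E ≡ size F
  size-exchange E F ι ι∘ι≡id into back = size-bij E F ι
    (λ {x} {y} _ _ ιx≡ιy → trans (sym (ι∘ι≡id x)) (trans (cong ι ιx≡ιy) (ι∘ι≡id y)))
    into (λ {y} qy → ι y , back qy , ι∘ι≡id y)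

  restrict : Enumeration P → Decidable R → Enumeration (P ∩ R)
  restrict E R? = record
    { elements = filter R? (elements E)
    ; unique   = Unique.filter⁺ R? (unique E)
    ; sound    = λ m → let (x∈ , rx) = ∈-filter⁻ R? m in sound E x∈ , rx
    ; complete = λ (px , rx) → ∈-filter⁺ R? (complete E px) rx
    }

  length-filter-∁ : (R? : Decidable R) (xs : List A) →
                    length xs ≡ length (filter R? xs) + length (filter (∁? R?) xs)
  length-filter-∁ R? []       = refl
  length-filter-∁ R? (x ∷ xs) with R? x
  ... | yes _ = cong suc (length-filter-∁ R? xs)
  ... | no  _ = trans (cong suc (length-filter-∁ R? xs)) (sym (+-suc _ _))

  size-split : (E : Enumeration P) (R? : Decidable R) →
               size E ≡ size (restrict E R?) + size (restrict E (∁? R?))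
  size-split E R? = length-filter-∁ R? (elements E)

  Flips : (A → A) → Pred A 0ℓ → Pred A 0ℓ
  Flips ι R x = (R x → ¬ R (ι x)) × (¬ R x → R (ι x))

  flips? : (ι : A → A) → Decidable R → Decidable (Flips ι R)
  flips? ι R? x = (R? x →-dec ¬? (R? (ι x))) ×-dec (¬? (R? x) →-dec R? (ι x))

  size-halve : (E : Enumeration P) (R? : Decidable R) (ι : A → A) → (∀ x → ι (ι x) ≡ x) →
               (∀ {x} → P x → P (ι x)) → (∀ {x} → P x → Flips ι R x) →
               size E ≡ 2 * size (restrict E R?)
  size-halve E R? ι ι∘ι≡id ι-closed flips = begin
    size E              ≡⟨ size-split E R? ⟩
    size E∩R + size E∖R ≡⟨ cong (size E∩R +_) (size-exchange E∖R E∩R ι ι∘ι≡id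
                              (λ (px , ¬rx) → ι-closed px , proj₂ (flips px) ¬rx)
                              (λ (px , rx) → ι-closed px , proj₁ (flips px) rx)) ⟩
    size E∩R + size E∩R ≡⟨ double (size E∩R) ⟩
    2 * size E∩R        ∎
    where
    open ≡-Reasoning
    E∩R = restrict E R?
    E∖R = restrict E (∁? R?)
    double : ∀ n → n + n ≡ 2 * n
    double = solve-∀

module Congruences where

  open import Data.Nat as ℕ using (ℕ; NonZero)
  import Data.Nat.Divisibility as ℕᵈ
  open import Data.Integer using (ℤ; +_; _+_; _-_; -_; _*_; 0ℤ; _%ℕ_; _/ℕ_)
  open import Data.Integer.DivMod using (a≡a%ℕn+[a/ℕn]*n; n%ℕd<d)
  open import Data.Integer.Divisibility.Signed
    using (_∣_; divides; _∣?_; ∣ᵤ⇒∣; ∣-trans; ∣m∣n⇒∣m+n; ∣m⇒∣-m; ∣n⇒∣m*n; ∣m⇒∣m*n)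
  open import Data.Integer.Properties using (+-inverseʳ; pos-*)
  open import Data.Integer.Tactic.RingSolver using (solve; solve-∀)
  open import Data.Fin using (Fin; toℕ; fromℕ<)
  open import Data.Fin.Properties using (toℕ-fromℕ<)
  open import Data.List using (_∷_; [])
  open import Relation.Binary.PropositionalEquality
    using (_≡_; refl; sym; trans; cong; module ≡-Reasoning)
  open import Relation.Nullary using (Dec)
  open import Function using (_⇔_; mk⇔)
  open import Relation.Nullary.Decidable using (map′)

  infix 4 _≡_[mod_]

  record _≡_[mod_] (x y : ℤ) (m : ℕ) : Set where
    constructor congruent
    field divides-difference : + m ∣ x - y

  open _≡_[mod_] public

  _≡?_[mod_] : ∀ x y m → Dec (x ≡ y [mod m ])
  x ≡? y [mod m ] = map′ congruent divides-difference (+ m ∣? x - y)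

  private
    variable
      m : ℕ
      k x y z u v : ℤ

    infixl 1 _∣by_
    _∣by_ : k ∣ x → x ≡ y → k ∣ y
    k∣x ∣by refl = k∣x

  ≡mod-refl : x ≡ x [mod m ]
  ≡mod-refl {x = x} = congruent (divides 0ℤ (+-inverseʳ x))

  ≡mod-sym : x ≡ y [mod m ] → y ≡ x [mod m ]
  ≡mod-sym {x = x} {y = y} (congruent p) = congruent (∣m⇒∣-m p ∣by solve (x ∷ y ∷ []))

  ≡mod-trans : x ≡ y [mod m ] → y ≡ z [mod m ] → x ≡ z [mod m ]
  ≡mod-trans {x = x} {y = y} {z = z} (congruent p) (congruent q) =
    congruent (∣m∣n⇒∣m+n p q ∣by solve (x ∷ y ∷ z ∷ []))

  +-cong : x ≡ y [mod m ] → u ≡ v [mod m ] → x + u ≡ y + v [mod m ]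
  +-cong {x = x} {y = y} {u = u} {v = v} (congruent p) (congruent q) =
    congruent (∣m∣n⇒∣m+n p q ∣by solve (x ∷ y ∷ u ∷ v ∷ []))

  neg-cong : x ≡ y [mod m ] → - x ≡ - y [mod m ]
  neg-cong {x = x} {y = y} (congruent p) = congruent (∣m⇒∣-m p ∣by solve (x ∷ y ∷ []))

  *-cong : x ≡ y [mod m ] → u ≡ v [mod m ] → x * u ≡ y * v [mod m ]
  *-cong {x = x} {y = y} {u = u} {v = v} (congruent p) (congruent q) =
    congruent (∣m∣n⇒∣m+n (∣m⇒∣m*n u p) (∣n⇒∣m*n y q) ∣by solve (x ∷ y ∷ u ∷ v ∷ []))

  *-congˡ : ∀ k → x ≡ y [mod m ] → k * x ≡ k * y [mod m ]
  *-congˡ k = *-cong (≡mod-refl {x = k})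

  ≡mod-resp : x ≡ u [mod m ] → y ≡ v [mod m ] → (x ≡ y [mod m ]) ⇔ (u ≡ v [mod m ])
  ≡mod-resp x≡u y≡v = mk⇔ (λ x≡y → ≡mod-trans (≡mod-sym x≡u) (≡mod-trans x≡y y≡v))
                          (λ u≡v → ≡mod-trans x≡u (≡mod-trans u≡v (≡mod-sym y≡v)))

  ≡mod-weaken : ∀ {d} → d ℕᵈ.∣ m → x ≡ y [mod m ] → x ≡ y [mod d ]
  ≡mod-weaken d∣m (congruent p) = congruent (∣-trans (∣ᵤ⇒∣ d∣m) p)

  square-cong : ∀ h → x ≡ y [mod 2 ℕ.* h ] → x * x ≡ y * y [mod 4 ℕ.* h ]
  square-cong {x = x} {y = y} h (congruent (divides q x-y≡q2h)) =
    congruent (divides (q * (q * + h + y)) (begin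
      x * x - y * y                                 ≡⟨ solve (x ∷ y ∷ []) ⟩
      (x - y) * (x - y + + 2 * y)                   ≡⟨ cong (λ δ → δ * (δ + + 2 * y)) x-y≡q2h ⟩
      q * + (2 ℕ.* h) * (q * + (2 ℕ.* h) + + 2 * y) ≡⟨ cong (λ M → q * M * (q * M + + 2 * y)) (pos-* 2 h) ⟩
      q * (+ 2 * + h) * (q * (+ 2 * + h) + + 2 * y) ≡⟨ expand q (+ h) y ⟩
      q * (q * + h + y) * (+ 4 * + h)               ≡⟨ cong (q * (q * + h + y) *_) (sym (pos-* 4 h)) ⟩
      q * (q * + h + y) * + (4 ℕ.* h)               ∎))
    where
    open ≡-Reasoning
    expand : ∀ q h y → q * (+ 2 * h) * (q * (+ 2 * h) + + 2 * y) ≡ q * (q * h + y) * (+ 4 * h)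
    expand = solve-∀

  module _ (m : ℕ) .{{_ : NonZero m}} where

    residue : ℤ → Fin m
    residue x = fromℕ< (n%ℕd<d x m)

    ≡-residue : ∀ x → x ≡ + toℕ (residue x) [mod m ]
    ≡-residue x rewrite toℕ-fromℕ< (n%ℕd<d x m) =
      congruent (divides (x /ℕ m) (trans (cong (_- r) (a≡a%ℕn+[a/ℕn]*n x m)) (cancel r (x /ℕ m) (+ m))))
      where
      r = + (x %ℕ m)
      cancel : ∀ r q M → r + q * M - r ≡ q * M
      cancel = solve-∀

module QuaternaryForm where

  open FiniteSets
  open Congruences

  open import Data.Nat as ℕ using (ℕ; NonZero)
  open import Data.Nat.Divisibility using (_∣_; divides)
  open import Data.Integer using (ℤ; +_; _+_; _-_; -_; _*_; 0ℤ)
  open import Data.Integer.Divisibility.Signed using (divides)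
  open import Data.Integer.Properties using (*-comm; *-cancelʳ-≡; *-cancelˡ-≡; +-identityʳ; neg-involutive)
  open import Data.Integer.Tactic.RingSolver using (solve-∀)
  open import Data.Fin using (Fin; toℕ)
  open import Data.Fin.Properties using (all?)
  open import Data.Product using (∃; _×_; _,_)
  open import Data.Product.Function.NonDependent.Propositional using (_×-⇔_)
  open import Function using (_∘_; _∋_; _⇔_; Equivalence)
  open import Function.Related.TypeIsomorphisms using (→-cong-⇔; ¬-cong-⇔)
  open import Level using (0ℓ)
  open import Relation.Binary.PropositionalEquality using (_≡_; refl; sym; trans; cong; subst)
  open import Relation.Nullary using (¬_; ¬?)
  open import Relation.Nullary.Decidable using (True; toWitness; _×-dec_; _→-dec_)
  open import Relation.Unary using (Pred; Decidable; ∁)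

  ℤ⁴ : Set
  ℤ⁴ = ℤ × ℤ × ℤ × ℤ

  π₁ π₂ π₃ π₄ : ℤ⁴ → ℤ
  π₁ (a , _ , _ , _) = a
  π₂ (_ , b , _ , _) = b
  π₃ (_ , _ , c , _) = c
  π₄ (_ , _ , _ , d) = d

  ℤ⁴-≡ : ∀ {a b c d a′ b′ c′ d′ : ℤ} → a ≡ a′ → b ≡ b′ → c ≡ c′ → d ≡ d′ →
         (ℤ⁴ ∋ (a , b , c , d)) ≡ (a′ , b′ , c′ , d′)
  ℤ⁴-≡ refl refl refl refl = refl

  Q : ℤ⁴ → ℤ
  Q (a , b , c , d) = a * a + b * b + c * c + + 6 * (d * d)

  Rep : ℤ → Pred ℤ⁴ 0ℓ
  Rep k v = Q v ≡ k

  odd⁴ : ℤ⁴ → ℤ⁴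
  odd⁴ (a , b , c , d) = + 2 * a - + 1 , + 2 * b - + 1 , + 2 * c - + 1 , + 2 * d - + 1

  OddRep : ℤ → Pred ℤ⁴ 0ℓ
  OddRep k = Rep k ∘ odd⁴

  Even Odd : Pred ℤ 0ℓ
  Even x = x ≡ 0ℤ [mod 2 ]
  Odd = ∁ Even

  even? : Decidable Even
  even? x = x ≡? 0ℤ [mod 2 ]

  Opp₁₄ Eq₁₂ OddSum₁₂ : Pred ℤ⁴ 0ℓ
  Opp₁₄ (a , _ , _ , d) = a ≡ - d [mod 4 ]
  Eq₁₂ (a , b , _ , _) = a ≡ b [mod 4 ]
  OddSum₁₂ (a , b , _ , _) = Odd (a + b)

  opp₁₄? : Decidable Opp₁₄
  opp₁₄? (a , _ , _ , d) = a ≡? - d [mod 4 ]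

  eq₁₂? : Decidable Eq₁₂
  eq₁₂? (a , b , _ , _) = a ≡? b [mod 4 ]

  oddSum₁₂? : Decidable OddSum₁₂
  oddSum₁₂? (a , b , _ , _) = ¬? (even? (a + b))

  double swap₂₃ swap₁₃ neg₂ neg₄ flip₂ : ℤ⁴ → ℤ⁴
  double (a , b , c , d) = + 2 * a , + 2 * b , + 2 * c , + 2 * d
  swap₂₃ (a , b , c , d) = a , c , b , d
  swap₁₃ (a , b , c , d) = c , b , a , d
  neg₂ (a , b , c , d) = a , - b , c , d
  neg₄ (a , b , c , d) = a , b , c , - d
  flip₂ (a , b , c , d) = a , + 1 - b , c , d

  double-injective : ∀ {v w} → double v ≡ double w → v ≡ w
  double-injective {a , b , c , d} {a′ , b′ , c′ , d′} eq =
    ℤ⁴-≡ (*-cancelˡ-≡ (+ 2) a a′ (cong π₁ eq)) (*-cancelˡ-≡ (+ 2) b b′ (cong π₂ eq))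
         (*-cancelˡ-≡ (+ 2) c c′ (cong π₃ eq)) (*-cancelˡ-≡ (+ 2) d d′ (cong π₄ eq))

  neg₂-involutive : ∀ v → neg₂ (neg₂ v) ≡ v
  neg₂-involutive (a , b , c , d) = cong (λ t → a , t , c , d) (neg-involutive b)

  neg₄-involutive : ∀ v → neg₄ (neg₄ v) ≡ v
  neg₄-involutive (a , b , c , d) = cong (λ t → a , b , c , t) (neg-involutive d)

  flip₂-involutive : ∀ v → flip₂ (flip₂ v) ≡ v
  flip₂-involutive (a , b , c , d) = cong (λ t → a , t , c , d) (reflect b)
    where
    reflect : ∀ b → + 1 - (+ 1 - b) ≡ b
    reflect = solve-∀

  neg-square : ∀ x → - x * - x ≡ x * x
  neg-square = solve-∀

  Q-double : ∀ v → Q (double v) ≡ + 4 * Q v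
  Q-double (a , b , c , d) = expand a b c d
    where
    expand : ∀ a b c d →
      + 2 * a * (+ 2 * a) + + 2 * b * (+ 2 * b) + + 2 * c * (+ 2 * c) + + 6 * (+ 2 * d * (+ 2 * d)) ≡
      + 4 * (a * a + b * b + c * c + + 6 * (d * d))
    expand = solve-∀

  Q-swap₂₃ : ∀ v → Q (swap₂₃ v) ≡ Q v
  Q-swap₂₃ (a , b , c , d) = exchange (a * a) (b * b) (c * c) (+ 6 * (d * d))
    where
    exchange : ∀ p q r s → p + r + q + s ≡ p + q + r + s
    exchange = solve-∀

  Q-swap₁₃ : ∀ v → Q (swap₁₃ v) ≡ Q v
  Q-swap₁₃ (a , b , c , d) = exchange (a * a) (b * b) (c * c) (+ 6 * (d * d))
    where
    exchange : ∀ p q r s → r + q + p + s ≡ p + q + r + s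
    exchange = solve-∀

  Q-neg₂ : ∀ v → Q (neg₂ v) ≡ Q v
  Q-neg₂ (a , b , c , d) = cong (λ t → a * a + t + c * c + + 6 * (d * d)) (neg-square b)

  Q-neg₄ : ∀ v → Q (neg₄ v) ≡ Q v
  Q-neg₄ (a , b , c , d) = cong (λ t → a * a + b * b + c * c + + 6 * t) (neg-square d)

  Q-odd⁴-flip₂ : ∀ x → Q (odd⁴ (flip₂ x)) ≡ Q (odd⁴ x)
  Q-odd⁴-flip₂ (a , b , c , d) =
    trans (cong (λ t → u₁ * u₁ + t * t + u₃ * u₃ + + 6 * (u₄ * u₄)) (reflect b))
          (cong (λ t → u₁ * u₁ + t + u₃ * u₃ + + 6 * (u₄ * u₄)) (neg-square (+ 2 * b - + 1)))
    where
    u₁ = + 2 * a - + 1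
    u₃ = + 2 * c - + 1
    u₄ = + 2 * d - + 1
    reflect : ∀ b → + 2 * (+ 1 - b) - + 1 ≡ - (+ 2 * b - + 1)
    reflect = solve-∀

  infix 4 _≈_[mod_]

  _≈_[mod_] : ℤ⁴ → ℤ⁴ → ℕ → Set
  v ≈ w [mod m ] =
    π₁ v ≡ π₁ w [mod m ] × π₂ v ≡ π₂ w [mod m ] × π₃ v ≡ π₃ w [mod m ] × π₄ v ≡ π₄ w [mod m ]

  ≈-weaken : ∀ {m d v w} → d ∣ m → v ≈ w [mod m ] → v ≈ w [mod d ]
  ≈-weaken d∣m (a , b , c , d) =
    ≡mod-weaken d∣m a , ≡mod-weaken d∣m b , ≡mod-weaken d∣m c , ≡mod-weaken d∣m d

  module _ (m : ℕ) .{{_ : NonZero m}} where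

    reduce : ℤ⁴ → ℤ⁴
    reduce (a , b , c , d) =
      + toℕ (residue m a) , + toℕ (residue m b) , + toℕ (residue m c) , + toℕ (residue m d)

    ≈-reduce : ∀ v → v ≈ reduce v [mod m ]
    ≈-reduce (a , b , c , d) = ≡-residue m a , ≡-residue m b , ≡-residue m c , ≡-residue m d

    -- The implicit argument is found by evaluating P? on all m⁴ residue vectors.
    by-residues : {P : Pred ℤ⁴ 0ℓ} (P? : Decidable P) →
                  (∀ {v w} → v ≈ w [mod m ] → P v ⇔ P w) →
                  {True (all? λ (i : Fin m) → all? λ (j : Fin m) → all? λ (k : Fin m) →
                         all? λ (l : Fin m) → P? (+ toℕ i , + toℕ j , + toℕ k , + toℕ l))} →
                  ∀ v → P v
    by-residues P? P-cong {residues-checked} v@(a , b , c , d) =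
      Equivalence.from (P-cong {v} {reduce v} (≈-reduce v))
        (toWitness residues-checked (residue m a) (residue m b) (residue m c) (residue m d))

  Q-cong : ∀ h {v w} → v ≈ w [mod 2 ℕ.* h ] → Q v ≡ Q w [mod 4 ℕ.* h ]
  Q-cong h (a , b , c , d) =
    +-cong (+-cong (+-cong (square-cong h a) (square-cong h b)) (square-cong h c))
           (*-congˡ (+ 6) (square-cong h d))

  Even-cong : ∀ {x y} → x ≡ y [mod 2 ] → Even x ⇔ Even y
  Even-cong x≡y = ≡mod-resp x≡y ≡mod-refl

  Odd-cong : ∀ {x y} → x ≡ y [mod 2 ] → Odd x ⇔ Odd y
  Odd-cong = ¬-cong-⇔ ∘ Even-cong

  Odd-neg : ∀ {x} → Odd x → Odd (- x)
  Odd-neg {x} odd even-neg = odd (subst Even (neg-involutive x) (neg-cong even-neg))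

  even-double : ∀ x → Even (+ 2 * x)
  even-double x = congruent (divides x (trans (+-identityʳ (+ 2 * x)) (*-comm (+ 2) x)))

  halve : ∀ {x} → Even x → ∃ λ y → + 2 * y ≡ x
  halve {x} (congruent (divides y x-0≡y2)) =
    y , trans (*-comm (+ 2) y) (sym (trans (sym (+-identityʳ x)) x-0≡y2))

  all-even⇒double : ∀ {v} → Even (π₁ v) → Even (π₂ v) → Even (π₃ v) → Even (π₄ v) → ∃ λ u → double u ≡ v
  all-even⇒double ea eb ec ed with halve ea | halve eb | halve ec | halve ed
  ... | a , 2a≡ | b , 2b≡ | c , 2c≡ | d , 2d≡ = (a , b , c , d) , ℤ⁴-≡ 2a≡ 2b≡ 2c≡ 2d≡

  Opp₁₄-cong : ∀ {v w} → v ≈ w [mod 4 ] → Opp₁₄ v ⇔ Opp₁₄ w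
  Opp₁₄-cong (a , _ , _ , d) = ≡mod-resp a (neg-cong d)

  Eq₁₂-cong : ∀ {v w} → v ≈ w [mod 4 ] → Eq₁₂ v ⇔ Eq₁₂ w
  Eq₁₂-cong (a , b , _ , _) = ≡mod-resp a b

  OddSum₁₂-cong : ∀ {v w} → v ≈ w [mod 2 ] → OddSum₁₂ v ⇔ OddSum₁₂ w
  OddSum₁₂-cong (a , b , _ , _) = Odd-cong (+-cong a b)

  Flips-cong : ∀ {m} ι {R} → (∀ {v w} → v ≈ w [mod m ] → R v ⇔ R w) →
               (∀ {v w} → v ≈ w [mod m ] → ι v ≈ ι w [mod m ]) →
               ∀ {v w} → v ≈ w [mod m ] → Flips ι R v ⇔ Flips ι R w
  Flips-cong ι R-cong ι-cong v≈w =
    →-cong-⇔ (R-cong v≈w) (¬-cong-⇔ (R-cong (ι-cong v≈w))) ×-⇔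
    →-cong-⇔ (¬-cong-⇔ (R-cong v≈w)) (R-cong (ι-cong v≈w))

  Parities : Pred ℤ⁴ 0ℓ
  Parities (a , b , c , d) =
    (Even d → Even a × Even b × Even c) ×
    (Odd d → Even c → Odd a × Odd b) ×
    (Odd d → Odd c → Odd b → Even a)

  -- The proofs below contain the residue computations; they are opaque so that nothing unfolds them.
  opaque
    Q≡4[8]⇒parities : ∀ v → Q v ≡ + 4 [mod 8 ] → Parities v
    Q≡4[8]⇒parities = by-residues 4 decide respects
      where
      decide : Decidable (λ v → Q v ≡ + 4 [mod 8 ] → Parities v)
      decide v@(a , b , c , d) = (Q v ≡? + 4 [mod 8 ]) →-dec
        ((even? d →-dec even? a ×-dec even? b ×-dec even? c) ×-dec
         (¬? (even? d) →-dec even? c →-dec ¬? (even? a) ×-dec ¬? (even? b)) ×-dec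
         (¬? (even? d) →-dec ¬? (even? c) →-dec ¬? (even? b) →-dec even? a))
      respects : ∀ {v w} → v ≈ w [mod 4 ] →
                 (Q v ≡ + 4 [mod 8 ] → Parities v) ⇔ (Q w ≡ + 4 [mod 8 ] → Parities w)
      respects v≈w with ≈-weaken (divides 2 refl) v≈w
      ... | (a , b , c , d) = →-cong-⇔ (≡mod-resp (Q-cong 2 v≈w) ≡mod-refl)
        ((→-cong-⇔ (Even-cong d) (Even-cong a ×-⇔ Even-cong b ×-⇔ Even-cong c)) ×-⇔
         (→-cong-⇔ (Odd-cong d) (→-cong-⇔ (Even-cong c) (Odd-cong a ×-⇔ Odd-cong b))) ×-⇔
         (→-cong-⇔ (Odd-cong d) (→-cong-⇔ (Odd-cong c) (→-cong-⇔ (Odd-cong b) (Even-cong a)))))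

  opaque
    neg₄-flips-Opp₁₄ : ∀ v → Odd (π₁ v) → Odd (π₄ v) → Flips neg₄ Opp₁₄ v
    neg₄-flips-Opp₁₄ = by-residues 4 decide respects
      where
      decide : Decidable (λ v → Odd (π₁ v) → Odd (π₄ v) → Flips neg₄ Opp₁₄ v)
      decide v = ¬? (even? (π₁ v)) →-dec ¬? (even? (π₄ v)) →-dec flips? neg₄ opp₁₄? v
      respects : ∀ {v w} → v ≈ w [mod 4 ] →
                 (Odd (π₁ v) → Odd (π₄ v) → Flips neg₄ Opp₁₄ v) ⇔
                 (Odd (π₁ w) → Odd (π₄ w) → Flips neg₄ Opp₁₄ w)
      respects v≈w@(a , b , c , d) with ≈-weaken (divides 2 refl) v≈w
      ... | (a₂ , _ , _ , d₂) = →-cong-⇔ (Odd-cong a₂) (→-cong-⇔ (Odd-cong d₂)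
        (Flips-cong neg₄ Opp₁₄-cong (λ (a , b , c , d) → a , b , c , neg-cong d) v≈w))

  opaque
    neg₂-flips-Eq₁₂ : ∀ v → Odd (π₁ v) → Odd (π₂ v) → Flips neg₂ Eq₁₂ v
    neg₂-flips-Eq₁₂ = by-residues 4 decide respects
      where
      decide : Decidable (λ v → Odd (π₁ v) → Odd (π₂ v) → Flips neg₂ Eq₁₂ v)
      decide v = ¬? (even? (π₁ v)) →-dec ¬? (even? (π₂ v)) →-dec flips? neg₂ eq₁₂? v
      respects : ∀ {v w} → v ≈ w [mod 4 ] →
                 (Odd (π₁ v) → Odd (π₂ v) → Flips neg₂ Eq₁₂ v) ⇔
                 (Odd (π₁ w) → Odd (π₂ w) → Flips neg₂ Eq₁₂ w)
      respects v≈w with ≈-weaken (divides 2 refl) v≈w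
      ... | (a₂ , b₂ , _ , _) = →-cong-⇔ (Odd-cong a₂) (→-cong-⇔ (Odd-cong b₂)
        (Flips-cong neg₂ Eq₁₂-cong (λ (a , b , c , d) → a , neg-cong b , c , d) v≈w))

  opaque
    flip₂-flips-OddSum₁₂ : ∀ x → Flips flip₂ OddSum₁₂ x
    flip₂-flips-OddSum₁₂ = by-residues 2 (flips? flip₂ oddSum₁₂?)
      (Flips-cong flip₂ OddSum₁₂-cong
        (λ (a , b , c , d) → a , +-cong (≡mod-refl {x = + 1}) (neg-cong b) , c , d))

  -- With u = odd⁴ x, φ x = (a′, b′, 2 u₃, d′) where (a′, b′, d′) = A (u₁, u₂, u₄) / 2 for
  -- A = [[3,-1,6],[-1,3,6],[1,1,-2]].  Since Aᵀ D A = 16 D for D = diag(1,1,6), Q (φ x) = 4 Q u;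
  -- since A² = 16 I, applying A once more (as φ⁺ does) inverts φ up to scale.
  φ : ℤ⁴ → ℤ⁴
  φ (a , b , c , d) =
    + 3 * a - b + + 6 * d - + 4 , - a + + 3 * b + + 6 * d - + 4 , + 4 * c - + 2 , a + b - + 2 * d

  Q∘φ : ∀ x → Q (φ x) ≡ + 4 * Q (odd⁴ x)
  Q∘φ (a , b , c , d) = expand a b c d
    where
    expand : ∀ a b c d →
      let a′ = + 3 * a - b + + 6 * d - + 4
          b′ = - a + + 3 * b + + 6 * d - + 4
          c′ = + 4 * c - + 2
          d′ = a + b - + 2 * d
          u₁ = + 2 * a - + 1
          u₂ = + 2 * b - + 1
          u₃ = + 2 * c - + 1
          u₄ = + 2 * d - + 1
      in a′ * a′ + b′ * b′ + c′ * c′ + + 6 * (d′ * d′) ≡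
         + 4 * (u₁ * u₁ + u₂ * u₂ + u₃ * u₃ + + 6 * (u₄ * u₄))
    expand = solve-∀

  φ₄≡₁+₂ : ∀ x → π₄ (φ x) ≡ π₁ x + π₂ x [mod 2 ]
  φ₄≡₁+₂ (a , b , c , d) = congruent (divides (- d) (identity a b d))
    where
    identity : ∀ a b d → a + b - + 2 * d - (a + b) ≡ - d * + 2
    identity = solve-∀

  φ-residues : ∀ x → OddSum₁₂ x → Odd (π₄ (φ x)) × Even (π₃ (φ x)) × Opp₁₄ (φ x) × Eq₁₂ (φ x)
  φ-residues (a , b , c , d) odd =
    Equivalence.from (Odd-cong (φ₄≡₁+₂ (a , b , c , d))) odd ,
    congruent (divides (+ 2 * c - + 1) (even c)) ,
    congruent (divides (a + d - + 1) (opp a b d)) ,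
    congruent (divides (a - b) (eq a b d))
    where
    even : ∀ c → + 4 * c - + 2 - 0ℤ ≡ (+ 2 * c - + 1) * + 2
    even = solve-∀
    opp : ∀ a b d → + 3 * a - b + + 6 * d - + 4 - - (a + b - + 2 * d) ≡ (a + d - + 1) * + 4
    opp = solve-∀
    eq : ∀ a b d → + 3 * a - b + + 6 * d - + 4 - (- a + + 3 * b + + 6 * d - + 4) ≡ (a - b) * + 4
    eq = solve-∀

  φ⁺ : ℤ⁴ → ℤ⁴
  φ⁺ (a , b , c , d) =
    + 3 * a - b + + 6 * d + + 8 , - a + + 3 * b + + 6 * d + + 8 , c + + 2 , a + b - + 2 * d + + 8

  scale : ℤ⁴ → ℤ⁴
  scale (a , b , c , d) = a * + 16 , b * + 16 , c * + 4 , d * + 16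

  φ⁺∘φ : ∀ x → φ⁺ (φ x) ≡ scale x
  φ⁺∘φ (a , b , c , d) = ℤ⁴-≡ (first a b d) (second a b d) (third c) (fourth a b d)
    where
    first : ∀ a b d → + 3 * (+ 3 * a - b + + 6 * d - + 4) - (- a + + 3 * b + + 6 * d - + 4)
                      + + 6 * (a + b - + 2 * d) + + 8 ≡ a * + 16
    first = solve-∀
    second : ∀ a b d → - (+ 3 * a - b + + 6 * d - + 4) + + 3 * (- a + + 3 * b + + 6 * d - + 4)
                       + + 6 * (a + b - + 2 * d) + + 8 ≡ b * + 16
    second = solve-∀
    third : ∀ c → + 4 * c - + 2 + + 2 ≡ c * + 4
    third = solve-∀
    fourth : ∀ a b d → + 3 * a - b + + 6 * d - + 4 + (- a + + 3 * b + + 6 * d - + 4)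
                       - + 2 * (a + b - + 2 * d) + + 8 ≡ d * + 16
    fourth = solve-∀

  scale-injective : ∀ {x y} → scale x ≡ scale y → x ≡ y
  scale-injective {a , b , c , d} {a′ , b′ , c′ , d′} eq =
    ℤ⁴-≡ (*-cancelʳ-≡ a a′ (+ 16) (cong π₁ eq)) (*-cancelʳ-≡ b b′ (+ 16) (cong π₂ eq))
         (*-cancelʳ-≡ c c′ (+ 4) (cong π₃ eq)) (*-cancelʳ-≡ d d′ (+ 16) (cong π₄ eq))

  φ-injective : ∀ {x y} → φ x ≡ φ y → x ≡ y
  φ-injective {x} {y} eq = scale-injective (trans (sym (φ⁺∘φ x)) (trans (cong φ⁺ eq) (φ⁺∘φ y)))

  φ⁺-injective : ∀ {v w} → φ⁺ v ≡ φ⁺ w → v ≡ w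
  φ⁺-injective {v} {w} eq =
    scale-injective (trans (sym (recover∘φ⁺ v)) (trans (cong recover eq) (recover∘φ⁺ w)))
    where
    recover : ℤ⁴ → ℤ⁴
    recover (p , q , r , s) =
      + 3 * p - q + + 6 * s - + 64 , - p + + 3 * q + + 6 * s - + 64 , + 4 * r - + 8 , p + q - + 2 * s
    first : ∀ a b d → + 3 * (+ 3 * a - b + + 6 * d + + 8) - (- a + + 3 * b + + 6 * d + + 8)
                      + + 6 * (a + b - + 2 * d + + 8) - + 64 ≡ a * + 16
    first = solve-∀
    second : ∀ a b d → - (+ 3 * a - b + + 6 * d + + 8) + + 3 * (- a + + 3 * b + + 6 * d + + 8)
                       + + 6 * (a + b - + 2 * d + + 8) - + 64 ≡ b * + 16
    second = solve-∀
    third : ∀ c → + 4 * (c + + 2) - + 8 ≡ c * + 4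
    third = solve-∀
    fourth : ∀ a b d → + 3 * a - b + + 6 * d + + 8 + (- a + + 3 * b + + 6 * d + + 8)
                       - + 2 * (a + b - + 2 * d + + 8) ≡ d * + 16
    fourth = solve-∀
    recover∘φ⁺ : ∀ v → recover (φ⁺ v) ≡ scale v
    recover∘φ⁺ (a , b , c , d) = ℤ⁴-≡ (first a b d) (second a b d) (third c) (fourth a b d)

  φ⁺-cong : ∀ {m v w} → v ≈ w [mod m ] → φ⁺ v ≈ φ⁺ w [mod m ]
  φ⁺-cong (a , b , c , d) =
    +-cong (+-cong (+-cong (*-congˡ (+ 3) a) (neg-cong b)) (*-congˡ (+ 6) d)) ≡mod-refl ,
    +-cong (+-cong (+-cong (neg-cong a) (*-congˡ (+ 3) b)) (*-congˡ (+ 6) d)) ≡mod-refl ,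
    +-cong c ≡mod-refl ,
    +-cong (+-cong (+-cong a b) (neg-cong (*-congˡ (+ 2) d))) ≡mod-refl

  Divisible : Pred ℤ⁴ 0ℓ
  Divisible (p , q , r , s) = p ≡ 0ℤ [mod 16 ] × q ≡ 0ℤ [mod 16 ] × r ≡ 0ℤ [mod 4 ] × s ≡ 0ℤ [mod 16 ]

  divisible? : Decidable Divisible
  divisible? (p , q , r , s) =
    p ≡? 0ℤ [mod 16 ] ×-dec q ≡? 0ℤ [mod 16 ] ×-dec r ≡? 0ℤ [mod 4 ] ×-dec s ≡? 0ℤ [mod 16 ]

  Divisible-cong : ∀ {v w} → v ≈ w [mod 16 ] → Divisible v ⇔ Divisible w
  Divisible-cong (p , q , r , s) =
    ≡mod-resp p ≡mod-refl ×-⇔ ≡mod-resp q ≡mod-refl ×-⇔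
    ≡mod-resp (≡mod-weaken (divides 4 refl) r) ≡mod-refl ×-⇔ ≡mod-resp s ≡mod-refl

  divisible⇒scale : ∀ {p} → Divisible p → ∃ λ y → scale y ≡ p
  divisible⇒scale {p , q , r , s} (congruent (divides y₁ e₁) , congruent (divides y₂ e₂) ,
                                   congruent (divides y₃ e₃) , congruent (divides y₄ e₄)) =
    (y₁ , y₂ , y₃ , y₄) , ℤ⁴-≡ (unshift p e₁) (unshift q e₂) (unshift r e₃) (unshift s e₄)
    where
    unshift : ∀ x {y} → x - 0ℤ ≡ y → y ≡ x
    unshift x x-0≡y = trans (sym x-0≡y) (+-identityʳ x)

  opaque
    Q≡4[32]⇒divisible : ∀ v → Q v ≡ + 4 [mod 32 ] → Odd (π₄ v) → Even (π₃ v) → Opp₁₄ v → Eq₁₂ v →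
                        Divisible (φ⁺ v)
    Q≡4[32]⇒divisible = by-residues 16 decide respects
      where
      P : Pred ℤ⁴ 0ℓ
      P v = Q v ≡ + 4 [mod 32 ] → Odd (π₄ v) → Even (π₃ v) → Opp₁₄ v → Eq₁₂ v → Divisible (φ⁺ v)
      decide : Decidable P
      decide v = (Q v ≡? + 4 [mod 32 ]) →-dec ¬? (even? (π₄ v)) →-dec even? (π₃ v) →-dec
                 opp₁₄? v →-dec eq₁₂? v →-dec divisible? (φ⁺ v)
      respects : ∀ {v w} → v ≈ w [mod 16 ] → P v ⇔ P w
      respects v≈w with ≈-weaken (divides 4 refl) v≈w | ≈-weaken (divides 8 refl) v≈w
      ... | v≈₄w | (_ , _ , c , d) =
        →-cong-⇔ (≡mod-resp (Q-cong 8 v≈w) ≡mod-refl) (→-cong-⇔ (Odd-cong d) (→-cong-⇔ (Even-cong c)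
        (→-cong-⇔ (Opp₁₄-cong v≈₄w) (→-cong-⇔ (Eq₁₂-cong v≈₄w) (Divisible-cong (φ⁺-cong v≈w))))))

module Counting where

  open FiniteSets
  open Congruences
  open QuaternaryForm

  open import Data.Nat using (ℕ; _+_; _*_)
  open import Data.Nat.Divisibility using (divides)
  open import Data.Nat.Tactic.RingSolver as ℕ-Solver using ()
  open import Data.Integer as ℤ using (ℤ; +_)
  open import Data.Integer.Divisibility.Signed using (divides)
  open import Data.Integer.Properties using (pos-*; *-cancelˡ-≡)
  open import Data.Integer.Tactic.RingSolver as ℤ-Solver using ()
  open import Data.Product using (∃; _×_; _,_; proj₁; proj₂)
  open import Function using (_∘_; Equivalence)
  open import Relation.Binary.PropositionalEquality
    using (_≡_; refl; sym; trans; cong; cong₂; subst; module ≡-Reasoning)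
  open import Level using (0ℓ)
  open import Relation.Unary using (Pred; _∩_)
  open import Relation.Unary.Properties using (∁?)

  module Decomposition {K m : ℕ} (K≡8m+1 : K ≡ 8 * m + 1) where

    private
      Rep4K Target : Pred ℤ⁴ 0ℓ
      Rep4K = Rep (+ (4 * K))
      Target = (((Rep4K ∩ Odd ∘ π₄) ∩ Even ∘ π₃) ∩ Opp₁₄) ∩ Eq₁₂

    Q≡4K⇒Q≡4[32] : ∀ v → Rep4K v → Q v ≡ + 4 [mod 32 ]
    Q≡4K⇒Q≡4[32] v Qv≡4K = congruent (divides (+ m) (begin
      Q v ℤ.- + 4                  ≡⟨ cong (ℤ._- + 4) (trans Qv≡4K (cong (λ k → + (4 * k)) K≡8m+1)) ⟩
      + (4 * (8 * m + 1)) ℤ.- + 4  ≡⟨ cong (λ k → + k ℤ.- + 4) (ℕ-identity m) ⟩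
      + (m * 32) ℤ.+ + 4 ℤ.- + 4   ≡⟨ ℤ-identity (+ (m * 32)) ⟩
      + (m * 32)                   ≡⟨ pos-* m 32 ⟩
      + m ℤ.* + 32                 ∎))
      where
      open ≡-Reasoning
      ℕ-identity : ∀ m → 4 * (8 * m + 1) ≡ m * 32 + 4
      ℕ-identity = ℕ-Solver.solve-∀
      ℤ-identity : ∀ x → x ℤ.+ + 4 ℤ.- + 4 ≡ x
      ℤ-identity = ℤ-Solver.solve-∀

    Q≡4K⇒parities : ∀ v → Rep4K v → Parities v
    Q≡4K⇒parities v = Q≡4[8]⇒parities v ∘ ≡mod-weaken (divides 4 refl) ∘ Q≡4K⇒Q≡4[32] v

    even₄⇒even₁₂₃ : ∀ v → Rep4K v → Even (π₄ v) → Even (π₁ v) × Even (π₂ v) × Even (π₃ v)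
    even₄⇒even₁₂₃ v = proj₁ ∘ Q≡4K⇒parities v

    odd₄∧even₃⇒odd₁₂ : ∀ v → Rep4K v → Odd (π₄ v) → Even (π₃ v) → Odd (π₁ v) × Odd (π₂ v)
    odd₄∧even₃⇒odd₁₂ v = proj₁ ∘ proj₂ ∘ Q≡4K⇒parities v

    odd₄∧odd₃∧odd₂⇒even₁ : ∀ v → Rep4K v → Odd (π₄ v) → Odd (π₃ v) → Odd (π₂ v) → Even (π₁ v)
    odd₄∧odd₃∧odd₂⇒even₁ v = proj₂ ∘ proj₂ ∘ Q≡4K⇒parities v

    rep-quarter : ∀ v u → Q v ≡ + 4 ℤ.* Q u → Rep4K v → Rep (+ K) u
    rep-quarter v u Qv≡4Qu Qv≡4K =
      *-cancelˡ-≡ (+ 4) (Q u) (+ K) (trans (sym Qv≡4Qu) (trans Qv≡4K (pos-* 4 K)))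

    rep-quadruple : ∀ v u → Q v ≡ + 4 ℤ.* Q u → Rep (+ K) u → Rep4K v
    rep-quadruple v u Qv≡4Qu Qu≡K = trans Qv≡4Qu (trans (cong (+ 4 ℤ.*_) Qu≡K) (sym (pos-* 4 K)))

    doubling : (E : Enumeration (Rep (+ K))) (F : Enumeration (Rep4K ∩ Even ∘ π₄)) → size E ≡ size F
    doubling E F = size-bij E F double (λ {v} {w} _ _ → double-injective {v} {w})
      (λ {v} Qv≡K → rep-quadruple (double v) v (Q-double v) Qv≡K , even-double (π₄ v)) onto
      where
      onto : ∀ {w} → (Rep4K ∩ Even ∘ π₄) w → ∃ λ v → Rep (+ K) v × double v ≡ w
      onto {w} (Qw≡4K , even₄) =
        let even₁ , even₂ , even₃ = even₄⇒even₁₂₃ w Qw≡4K even₄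
            v , double-v≡w = all-even⇒double {w} even₁ even₂ even₃ even₄
        in v , rep-quarter w v (trans (cong Q (sym double-v≡w)) (Q-double v)) Qw≡4K , double-v≡w

    threefold : (D : Enumeration (Rep4K ∩ Odd ∘ π₄)) → size D ≡ 3 * size (restrict D (even? ∘ π₃))
    threefold D = begin
      size D                            ≡⟨ size-split D (even? ∘ π₃) ⟩
      size E₃ + size O₃                 ≡⟨ cong (λ n → size E₃ + n) (size-split O₃ (even? ∘ π₂)) ⟩
      size E₃ + (size O₃E₂ + size O₃O₂) ≡⟨ cong (λ n → size E₃ + n) (cong₂ _+_ exchange₂₃ exchange₁₃) ⟩
      size E₃ + (size E₃ + size E₃)     ≡⟨ triple (size E₃) ⟩
      3 * size E₃                       ∎
      where
      open ≡-Reasoning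
      E₃ = restrict D (even? ∘ π₃)
      O₃ = restrict D (∁? (even? ∘ π₃))
      O₃E₂ = restrict O₃ (even? ∘ π₂)
      O₃O₂ = restrict O₃ (∁? (even? ∘ π₂))
      exchange₂₃ : size O₃E₂ ≡ size E₃
      exchange₂₃ = size-exchange O₃E₂ E₃ swap₂₃ (λ _ → refl)
        (λ {v} (((Qv≡4K , odd₄) , _) , even₂) → (trans (Q-swap₂₃ v) Qv≡4K , odd₄) , even₂)
        (λ {v} ((Qv≡4K , odd₄) , even₃) →
          ((trans (Q-swap₂₃ v) Qv≡4K , odd₄) , proj₂ (odd₄∧even₃⇒odd₁₂ v Qv≡4K odd₄ even₃)) , even₃)
      exchange₁₃ : size O₃O₂ ≡ size E₃
      exchange₁₃ = size-exchange O₃O₂ E₃ swap₁₃ (λ _ → refl)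
        (λ {v} (((Qv≡4K , odd₄) , odd₃) , odd₂) →
          (trans (Q-swap₁₃ v) Qv≡4K , odd₄) , odd₄∧odd₃∧odd₂⇒even₁ v Qv≡4K odd₄ odd₃ odd₂)
        (λ {v} ((Qv≡4K , odd₄) , even₃) → let odd₁ , odd₂ = odd₄∧even₃⇒odd₁₂ v Qv≡4K odd₄ even₃ in
          ((trans (Q-swap₁₃ v) Qv≡4K , odd₄) , odd₁) , odd₂)
      triple : ∀ n → n + (n + n) ≡ 3 * n
      triple = ℕ-Solver.solve-∀

    halve-neg₄ : (T : Enumeration ((Rep4K ∩ Odd ∘ π₄) ∩ Even ∘ π₃)) →
                 size T ≡ 2 * size (restrict T opp₁₄?)
    halve-neg₄ T = size-halve T opp₁₄? neg₄ neg₄-involutive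
      (λ {v} ((Qv≡4K , odd₄) , even₃) → (trans (Q-neg₄ v) Qv≡4K , Odd-neg odd₄) , even₃)
      (λ {v} ((Qv≡4K , odd₄) , even₃) →
        neg₄-flips-Opp₁₄ v (proj₁ (odd₄∧even₃⇒odd₁₂ v Qv≡4K odd₄ even₃)) odd₄)

    halve-neg₂ : (T : Enumeration (((Rep4K ∩ Odd ∘ π₄) ∩ Even ∘ π₃) ∩ Opp₁₄)) →
                 size T ≡ 2 * size (restrict T eq₁₂?)
    halve-neg₂ T = size-halve T eq₁₂? neg₂ neg₂-involutive
      (λ {v} (((Qv≡4K , odd₄) , even₃) , opp) → ((trans (Q-neg₂ v) Qv≡4K , odd₄) , even₃) , opp)
      (λ {v} (((Qv≡4K , odd₄) , even₃) , _) →
        let odd₁ , odd₂ = odd₄∧even₃⇒odd₁₂ v Qv≡4K odd₄ even₃ in neg₂-flips-Eq₁₂ v odd₁ odd₂)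

    halve-flip₂ : (F : Enumeration (OddRep (+ K))) → size F ≡ 2 * size (restrict F oddSum₁₂?)
    halve-flip₂ F = size-halve F oddSum₁₂? flip₂ flip₂-involutive
      (λ {x} Qx≡K → trans (Q-odd⁴-flip₂ x) Qx≡K) (λ {x} _ → flip₂-flips-OddSum₁₂ x)

    φ-bijection : (F : Enumeration (OddRep (+ K) ∩ OddSum₁₂)) (T : Enumeration Target) → size F ≡ size T
    φ-bijection F T =
      size-bij F T φ (λ {x} {y} _ _ → φ-injective {x} {y}) (λ {x} → into {x}) (λ {v} → onto {v})
      where
      into : ∀ {x} → (OddRep (+ K) ∩ OddSum₁₂) x → Target (φ x)
      into {x} (Qx≡K , odd-sum) =
        let odd₄ , even₃ , opp , eq = φ-residues x odd-sum
        in (((rep-quadruple (φ x) (odd⁴ x) (Q∘φ x) Qx≡K , odd₄) , even₃) , opp) , eq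
      onto : ∀ {v} → Target v → ∃ λ x → (OddRep (+ K) ∩ OddSum₁₂) x × φ x ≡ v
      onto {v} ((((Qv≡4K , odd₄) , even₃) , opp) , eq) =
        let Q≡4[32] = Q≡4K⇒Q≡4[32] v Qv≡4K
            x , scale-x≡φ⁺v = divisible⇒scale (Q≡4[32]⇒divisible v Q≡4[32] odd₄ even₃ opp eq)
            φx≡v = φ⁺-injective (trans (φ⁺∘φ x) scale-x≡φ⁺v)
        in x , (rep-quarter v (odd⁴ x) (trans (cong Q (sym φx≡v)) (Q∘φ x)) Qv≡4K ,
                Equivalence.to (Odd-cong (φ₄≡₁+₂ x)) (subst (Odd ∘ π₄) (sym φx≡v) odd₄)) , φx≡v

  representations-of-4K : ∀ {K} m → K ≡ 8 * m + 1 →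
                          (E₄ : Enumeration (Rep (+ (4 * K)))) (E₁ : Enumeration (Rep (+ K)))
                          (F : Enumeration (OddRep (+ K))) →
                          size E₄ ≡ size E₁ + 6 * size F
  representations-of-4K {K} m K≡8m+1 E₄ E₁ F = begin
    size E₄                           ≡⟨ size-split E₄ (even? ∘ π₄) ⟩
    size E₄∩Even₄ + size D            ≡⟨ cong₂ _+_ (sym (doubling E₁ E₄∩Even₄)) (threefold D) ⟩
    size E₁ + 3 * size T              ≡⟨ cong (λ n → size E₁ + 3 * n) (halve-neg₄ T) ⟩
    size E₁ + 3 * (2 * size T′)       ≡⟨ cong (λ n → size E₁ + 3 * (2 * n)) (halve-neg₂ T′) ⟩
    size E₁ + 3 * (2 * (2 * size T″)) ≡⟨ cong (λ n → size E₁ + 3 * (2 * (2 * n))) (sym (φ-bijection F₊ T″)) ⟩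
    size E₁ + 3 * (2 * (2 * size F₊)) ≡⟨ cong (λ n → size E₁ + n) (regroup (size F₊)) ⟩
    size E₁ + 6 * (2 * size F₊)       ≡⟨ cong (λ n → size E₁ + 6 * n) (sym (halve-flip₂ F)) ⟩
    size E₁ + 6 * size F              ∎
    where
    open ≡-Reasoning
    open Decomposition {K} {m} K≡8m+1
    E₄∩Even₄ = restrict E₄ (even? ∘ π₄)
    D = restrict E₄ (∁? (even? ∘ π₄))
    T = restrict D (even? ∘ π₃)
    T′ = restrict T opp₁₄?
    T″ = restrict T′ eq₁₂?
    F₊ = restrict F oddSum₁₂?
    regroup : ∀ n → 3 * (2 * (2 * n)) ≡ 6 * (2 * n)
    regroup = ℕ-Solver.solve-∀

module SolutionCounts where

  open FiniteSets
  open QuaternaryForm using (ℤ⁴; π₁; π₂; π₃; π₄; Q; odd⁴; Rep; OddRep)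

  open import Data.Nat using (ℕ; zero; suc; _+_; _*_; _≤_; _∸_; z≤n; s≤s; _/_)
  open import Data.Nat.DivMod using (m*n/n≡m)
  open import Data.Nat.Properties
    using (_≟_; ≤-refl; ≤-trans; ≤-reflexive; n≤1+n; m≤m+n; m≤n+m; m≤m*n; m∸n≤m; +-monoˡ-≤; *-monoˡ-≤;
           *-identityˡ; suc-injective; +-cancelʳ-≡; *-cancelˡ-≡)
  open import Data.Nat.Tactic.RingSolver as ℕ-Solver using ()
  open import Data.Integer as ℤ using (ℤ; +_; -[1+_]; ∣_∣; 0ℤ)
  open import Data.Integer.Properties using (pos-*; pos-+; +-injective; ⊖-≥; m-n≡m⊖n)
  open import Data.Integer.Tactic.RingSolver as ℤ-Solver using ()
  open import Data.List
    using (List; []; _∷_; _++_; length; map; concatMap; foldr; zipWith; cartesianProductWith)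
  open import Data.List.Membership.Propositional using (_∈_)
  open import Data.List.Membership.Propositional.Properties
    using (∈-map⁺; ∈-upTo⁺; ∈-cartesianProductWith⁺; ∈-cartesianProductWith⁻)
  open import Data.List.Properties using (∷-injective)
  open import Data.List.Relation.Unary.All as All using (All; []; _∷_)
  open import Data.List.Relation.Unary.Any using (here)
  open import Data.List.Relation.Unary.Unique.Propositional using (Unique; []; _∷_)
  import Data.List.Relation.Unary.Unique.Propositional.Properties as Unique
  open import Data.Product using (Σ-syntax; _×_; _,_)
  open import Function using (_⇔_; mk⇔; Equivalence)
  open import Level using (0ℓ)
  open import Relation.Binary.PropositionalEquality
    using (_≡_; refl; sym; trans; cong; cong₂; subst; module ≡-Reasoning)
  open import Relation.Unary using (Pred)

  coefficients : List ℕ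
  coefficients = 1 ∷ 1 ∷ 1 ∷ 6 ∷ []

  toList : ℤ⁴ → List ℤ
  toList (a , b , c , d) = a ∷ b ∷ c ∷ d ∷ []

  -- Only applied to lists of length 4; the junk value on other lists is never used.
  fromList : List ℤ → ℤ⁴
  fromList (a ∷ b ∷ c ∷ d ∷ _) = a , b , c , d
  fromList _                   = 0ℤ , 0ℤ , 0ℤ , 0ℤ

  tuples-suc : ∀ k r → tuples (suc k) r ≡ cartesianProductWith _∷_ r (tuples k r)
  tuples-suc k r = prepend r
    where
    prepend : ∀ s → concatMap (λ x → map (x ∷_) (tuples k r)) s ≡ cartesianProductWith _∷_ s (tuples k r)
    prepend []      = refl
    prepend (x ∷ s) = cong (map (x ∷_) (tuples k r) ++_) (prepend s)

  tuples-unique : ∀ k {r} → Unique r → Unique (tuples k r)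
  tuples-unique zero    _ = [] ∷ []
  tuples-unique (suc k) {r} r-unique rewrite tuples-suc k r =
    Unique.cartesianProductWith⁺ _∷_ ∷-injective r-unique (tuples-unique k r-unique)

  ∈-tuples : ∀ {r} xs → All (_∈ r) xs → xs ∈ tuples (length xs) r
  ∈-tuples         []       []           = here refl
  ∈-tuples {r = r} (x ∷ xs) (x∈r ∷ xs∈r) rewrite tuples-suc (length xs) r =
    ∈-cartesianProductWith⁺ _∷_ x∈r (∈-tuples xs xs∈r)

  length-tuples : ∀ k {r xs} → xs ∈ tuples k r → length xs ≡ k
  length-tuples zero    (here refl) = refl
  length-tuples (suc k) {r} xs∈ rewrite tuples-suc k r
    with ∈-cartesianProductWith⁻ _∷_ r (tuples k r) xs∈
  ... | _ , _ , _ , ys∈ , refl = cong suc (length-tuples k ys∈)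

  toList∘fromList : ∀ r {xs} → xs ∈ tuples 4 r → toList (fromList xs) ≡ xs
  toList∘fromList r {xs} xs∈ = lemma xs (length-tuples 4 {r} xs∈)
    where
    lemma : ∀ xs → length xs ≡ 4 → toList (fromList xs) ≡ xs
    lemma (a ∷ b ∷ c ∷ d ∷ []) refl = refl

  range-unique : ∀ B → Unique (range B)
  range-unique B = Unique.map⁺ (λ {i} {j} eq → +-injective (cancel (+ i) (+ j) (+ B) eq)) (Unique.upTo⁺ _)
    where
    cancel : ∀ x y b → x ℤ.- b ≡ y ℤ.- b → x ≡ y
    cancel x y b eq = trans (sym (shift x b)) (trans (cong (ℤ._+ b) eq) (shift y b))
      where
      shift : ∀ x b → x ℤ.- b ℤ.+ b ≡ x
      shift = ℤ-Solver.solve-∀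

  ∈-range : ∀ {B} z → ∣ z ∣ ≤ B → z ∈ range B
  ∈-range {B} (+ k) k≤B =
    subst (_∈ range B) (shift (+ k) (+ B)) (∈-map⁺ _ (∈-upTo⁺ (s≤s (+-monoˡ-≤ B k≤B))))
    where
    shift : ∀ x b → x ℤ.+ b ℤ.- b ≡ x
    shift = ℤ-Solver.solve-∀
  ∈-range {B} -[1+ k ] k<B =
    subst (_∈ range B) eq (∈-map⁺ _ (∈-upTo⁺ (s≤s (≤-trans (m∸n≤m B (suc k)) (m≤m+n B B)))))
    where
    shift : ∀ b s → b ℤ.- s ℤ.- b ≡ ℤ.- s
    shift = ℤ-Solver.solve-∀
    eq : + (B ∸ suc k) ℤ.- + B ≡ -[1+ k ]
    eq = trans (cong (ℤ._- + B) (sym (trans (m-n≡m⊖n B (suc k)) (⊖-≥ k<B)))) (shift (+ B) (+ suc k))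

  term≤form : ∀ f {as xs} → All (1 ≤_) as → length as ≡ length xs → All (λ x → f x ≤ form f as xs) xs
  term≤form f {[]}     {[]}     []            _   = []
  term≤form f {k ∷ as} {x ∷ xs} (1≤k ∷ 1≤as) len =
    ≤-trans (≤-trans (≤-reflexive (sym (*-identityˡ (f x)))) (*-monoˡ-≤ (f x) 1≤k)) (m≤m+n _ _) ∷
    All.map (λ le → ≤-trans le (m≤n+m _ _)) (term≤form f 1≤as (suc-injective len))

  count-enumerates : ∀ f → (∀ x → ∣ x ∣ ≤ suc (f x)) → ∀ n {P : Pred ℤ⁴ 0ℓ} →
                     (∀ v → form f coefficients (toList v) ≡ n ⇔ P v) →
                     Σ[ E ∈ Enumeration P ] count f coefficients n ≡ size E
  count-enumerates f ∣x∣≤1+f n {P} solution⇔P =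
    image L fromList injective into onto , sym (size-image L fromList injective into onto)
    where
    r = range (suc n)
    box = tuples 4 r
    L : Enumeration (λ xs → xs ∈ box × form f coefficients xs ≡ n)
    L = restrict (enumerate (tuples-unique 4 (range-unique (suc n)))) (λ xs → form f coefficients xs ≟ n)
    injective : ∀ {xs ys} → xs ∈ box × form f coefficients xs ≡ n → ys ∈ box × form f coefficients ys ≡ n →
                fromList xs ≡ fromList ys → xs ≡ ys
    injective (xs∈ , _) (ys∈ , _) eq =
      trans (sym (toList∘fromList r xs∈)) (trans (cong toList eq) (toList∘fromList r ys∈))
    into : ∀ {xs} → xs ∈ box × form f coefficients xs ≡ n → P (fromList xs)
    into {xs} (xs∈ , solution) = Equivalence.to (solution⇔P (fromList xs))
      (subst (λ ys → form f coefficients ys ≡ n) (sym (toList∘fromList r xs∈)) solution)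
    onto : ∀ {v} → P v → Σ[ xs ∈ List ℤ ] (xs ∈ box × form f coefficients xs ≡ n) × fromList xs ≡ v
    onto {v} pv = toList v , (toList-v∈box , solution) , refl
      where
      solution = Equivalence.from (solution⇔P v) pv
      positive : All (1 ≤_) coefficients
      positive = s≤s z≤n ∷ s≤s z≤n ∷ s≤s z≤n ∷ s≤s z≤n ∷ []
      in-range : ∀ {x} → f x ≤ form f coefficients (toList v) → x ∈ range (suc n)
      in-range {x} fx≤ = ∈-range x (≤-trans (∣x∣≤1+f x) (s≤s (≤-trans fx≤ (≤-reflexive solution))))
      toList-v∈box : toList v ∈ box
      toList-v∈box = ∈-tuples (toList v) (All.map in-range (term≤form f {xs = toList v} positive refl))

  +-form : ∀ (f : ℤ → ℕ) (g : ℤ → ℤ) → (∀ x → + f x ≡ g x) → ∀ as xs →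
           + form f as xs ≡ foldr ℤ._+_ 0ℤ (zipWith (λ k x → + k ℤ.* g x) as xs)
  +-form f g _   []       _        = refl
  +-form f g _   (_ ∷ _)  []       = refl
  +-form f g f≗g (k ∷ as) (x ∷ xs) = begin
    + (k * f x + form f as xs)     ≡⟨ pos-+ (k * f x) (form f as xs) ⟩
    + (k * f x) ℤ.+ + form f as xs ≡⟨ cong₂ ℤ._+_ (trans (pos-* k (f x)) (cong (+ k ℤ.*_) (f≗g x)))
                                                  (+-form f g f≗g as xs) ⟩
    _                              ∎
    where open ≡-Reasoning

  sq≡x*x : ∀ x → + sq x ≡ x ℤ.* x
  sq≡x*x (+ n)    = pos-* n n
  sq≡x*x -[1+ n ] = refl

  ∣x∣≤1+sq : ∀ x → ∣ x ∣ ≤ suc (sq x)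
  ∣x∣≤1+sq x = ≤-trans (n≤n*n ∣ x ∣) (n≤1+n _)
    where
    n≤n*n : ∀ n → n ≤ n * n
    n≤n*n zero    = z≤n
    n≤n*n (suc n) = m≤m*n (suc n) (suc n)

  +-form⁴ : ∀ (f : ℤ → ℕ) (g : ℤ → ℤ) → (∀ x → + f x ≡ g x) → ∀ v →
            + form f coefficients (toList v) ≡ g (π₁ v) ℤ.+ g (π₂ v) ℤ.+ g (π₃ v) ℤ.+ + 6 ℤ.* g (π₄ v)
  +-form⁴ f g f≗g v =
    trans (+-form f g f≗g coefficients (toList v)) (normalise (g (π₁ v)) (g (π₂ v)) (g (π₃ v)) (g (π₄ v)))
    where
    normalise : ∀ p q r s → + 1 ℤ.* p ℤ.+ (+ 1 ℤ.* q ℤ.+ (+ 1 ℤ.* r ℤ.+ (+ 6 ℤ.* s ℤ.+ 0ℤ))) ≡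
                            p ℤ.+ q ℤ.+ r ℤ.+ + 6 ℤ.* s
    normalise = ℤ-Solver.solve-∀

  N-enumerates : ∀ K → Σ[ E ∈ Enumeration (Rep (+ K)) ] N coefficients K ≡ size E
  N-enumerates K = count-enumerates sq ∣x∣≤1+sq K λ v →
    mk⇔ (λ solution → trans (sym (Q≡form v)) (cong +_ solution))
        (λ Qv≡K → +-injective (trans (Q≡form v) Qv≡K))
    where
    Q≡form : ∀ v → + form sq coefficients (toList v) ≡ Q v
    Q≡form = +-form⁴ sq (λ x → x ℤ.* x) sq≡x*x

  triangle : ℕ → ℕ
  triangle zero    = 0
  triangle (suc k) = suc k + triangle k

  triangle-double : ∀ k → suc k * k ≡ triangle k * 2
  triangle-double zero    = refl
  triangle-double (suc k) = begin
    suc (suc k) * suc k        ≡⟨ peel k ⟩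
    2 * suc k + suc k * k      ≡⟨ cong (λ n → 2 * suc k + n) (triangle-double k) ⟩
    2 * suc k + triangle k * 2 ≡⟨ regroup (suc k) (triangle k) ⟩
    triangle (suc k) * 2       ∎
    where
    open ≡-Reasoning
    peel : ∀ k → suc (suc k) * suc k ≡ 2 * suc k + suc k * k
    peel = ℕ-Solver.solve-∀
    regroup : ∀ a b → 2 * a + b * 2 ≡ (a + b) * 2
    regroup = ℕ-Solver.solve-∀

  n≤triangle : ∀ k → k ≤ triangle k
  n≤triangle zero    = z≤n
  n≤triangle (suc k) = m≤m+n (suc k) (triangle k)

  consecutive : ∀ x → Σ[ k ∈ ℕ ] x ℤ.* (x ℤ.- + 1) ≡ + (suc k * k) × ∣ x ∣ ≤ suc k
  consecutive (+ zero)  = 0 , refl , z≤n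
  consecutive (+ suc k) = k , sym (pos-* (suc k) k) , ≤-refl
  consecutive -[1+ k ]  = suc k , trans (mirror (+ k)) (sym (pos-* (suc (suc k)) (suc k))) , n≤1+n (suc k)
    where
    mirror : ∀ y → ℤ.- (+ 1 ℤ.+ y) ℤ.* (ℤ.- (+ 1 ℤ.+ y) ℤ.- + 1) ≡ (+ 2 ℤ.+ y) ℤ.* (+ 1 ℤ.+ y)
    mirror = ℤ-Solver.solve-∀

  tri≡triangle : ∀ x k → x ℤ.* (x ℤ.- + 1) ≡ + (suc k * k) → tri x ≡ triangle k
  tri≡triangle x k eq = begin
    ∣ x ℤ.* (x ℤ.- + 1) ∣ / 2 ≡⟨ cong (λ z → ∣ z ∣ / 2) eq ⟩
    suc k * k / 2             ≡⟨ cong (_/ 2) (triangle-double k) ⟩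
    triangle k * 2 / 2        ≡⟨ m*n/n≡m (triangle k) 2 ⟩
    triangle k                ∎
    where open ≡-Reasoning

  ∣x∣≤1+tri : ∀ x → ∣ x ∣ ≤ suc (tri x)
  ∣x∣≤1+tri x with consecutive x
  ... | k , eq , ∣x∣≤1+k = ≤-trans ∣x∣≤1+k (s≤s (subst (k ≤_) (sym (tri≡triangle x k eq)) (n≤triangle k)))

  8tri+1≡odd² : ∀ x → + (8 * tri x + 1) ≡ (+ 2 ℤ.* x ℤ.- + 1) ℤ.* (+ 2 ℤ.* x ℤ.- + 1)
  8tri+1≡odd² x with consecutive x
  ... | k , eq , _ = begin
    + (8 * tri x + 1)                       ≡⟨ cong (λ t → + (8 * t + 1)) (tri≡triangle x k eq) ⟩
    + (8 * triangle k + 1)                  ≡⟨ cong +_ (double-up (triangle k)) ⟩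
    + (4 * (triangle k * 2)) ℤ.+ + 1        ≡⟨ cong (λ n → + (4 * n) ℤ.+ + 1) (sym (triangle-double k)) ⟩
    + (4 * (suc k * k)) ℤ.+ + 1             ≡⟨ cong (ℤ._+ + 1) (pos-* 4 (suc k * k)) ⟩
    + 4 ℤ.* + (suc k * k) ℤ.+ + 1           ≡⟨ cong (λ z → + 4 ℤ.* z ℤ.+ + 1) (sym eq) ⟩
    + 4 ℤ.* (x ℤ.* (x ℤ.- + 1)) ℤ.+ + 1     ≡⟨ complete-square x ⟩
    (+ 2 ℤ.* x ℤ.- + 1) ℤ.* (+ 2 ℤ.* x ℤ.- + 1) ∎
    where
    open ≡-Reasoning
    double-up : ∀ t → 8 * t + 1 ≡ 4 * (t * 2) + 1
    double-up = ℕ-Solver.solve-∀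
    complete-square : ∀ x →
      + 4 ℤ.* (x ℤ.* (x ℤ.- + 1)) ℤ.+ + 1 ≡ (+ 2 ℤ.* x ℤ.- + 1) ℤ.* (+ 2 ℤ.* x ℤ.- + 1)
    complete-square = ℤ-Solver.solve-∀

  t-enumerates : ∀ n → Σ[ F ∈ Enumeration (OddRep (+ (8 * n + 9))) ] t coefficients n ≡ size F
  t-enumerates n = count-enumerates tri ∣x∣≤1+tri n λ x →
    mk⇔ (λ solution → trans (sym (Q∘odd⁴≡form x)) (cong (λ m → + (8 * m + 9)) solution))
        (λ Qx≡ → *-cancelˡ-≡ _ n 8 (+-cancelʳ-≡ 9 _ _ (+-injective (trans (Q∘odd⁴≡form x) Qx≡))))
    where
    Q∘odd⁴≡form : ∀ x → + (8 * form tri coefficients (toList x) + 9) ≡ Q (odd⁴ x)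
    Q∘odd⁴≡form x@(a , b , c , d) =
      trans (cong +_ (spread (tri a) (tri b) (tri c) (tri d)))
            (+-form⁴ (λ z → 8 * tri z + 1) (λ z → (+ 2 ℤ.* z ℤ.- + 1) ℤ.* (+ 2 ℤ.* z ℤ.- + 1)) 8tri+1≡odd² x)
      where
      spread : ∀ p q r s → 8 * (1 * p + (1 * q + (1 * r + (6 * s + 0)))) + 9 ≡
                           1 * (8 * p + 1) + (1 * (8 * q + 1) + (1 * (8 * r + 1) + (6 * (8 * s + 1) + 0)))
      spread = ℕ-Solver.solve-∀

open import Data.Nat using (ℕ; suc; _+_; _*_; _≤_)
open import Data.List using (_∷_; [])
open import Relation.Binary.PropositionalEquality using (_≡_)

open import Data.Nat.Properties using (+-comm)
open import Data.Nat.Tactic.RingSolver using (solve-∀)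
open import Data.Product using (_,_)
open import Relation.Binary.PropositionalEquality using (sym; cong; cong₂; module ≡-Reasoning)
open FiniteSets using (size)
open Counting using (representations-of-4K)
open SolutionCounts using (coefficients; N-enumerates; t-enumerates)

theorem5p15 : (n : ℕ) → 1 ≤ n →
    6 * t (1 ∷ 1 ∷ 1 ∷ 6 ∷ []) n + N (1 ∷ 1 ∷ 1 ∷ 6 ∷ []) (8 * n + 9)
      ≡ N (1 ∷ 1 ∷ 1 ∷ 6 ∷ []) (32 * n + 36)
theorem5p15 n _ =
  let E₄ , N≡E₄ = N-enumerates (4 * (8 * n + 9))
      E₁ , N≡E₁ = N-enumerates (8 * n + 9)
      F , t≡F = t-enumerates n
  in begin
    6 * t coefficients n + N coefficients (8 * n + 9) ≡⟨ cong₂ (λ x y → 6 * x + y) t≡F N≡E₁ ⟩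
    6 * size F + size E₁                              ≡⟨ +-comm (6 * size F) (size E₁) ⟩
    size E₁ + 6 * size F                              ≡⟨ sym (representations-of-4K (suc n) (K≡8[n+1]+1 n) E₄ E₁ F) ⟩
    size E₄                                           ≡⟨ sym N≡E₄ ⟩
    N coefficients (4 * (8 * n + 9))                  ≡⟨ cong (N coefficients) (4K≡32n+36 n) ⟩
    N coefficients (32 * n + 36)                      ∎
  where
  open ≡-Reasoning
  K≡8[n+1]+1 : ∀ n → 8 * n + 9 ≡ 8 * suc n + 1
  K≡8[n+1]+1 = solve-∀
  4K≡32n+36 : ∀ n → 4 * (8 * n + 9) ≡ 32 * n + 36
  4K≡32n+36 = solve-∀
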